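{- Let $\mathcal{G}$ be a cofinitary group, $r\in2^\omega$ and $(s,E)\in\mathbb{Z}^\dagger_\mathcal{G}(r)$. Then for every $(t,E)\in\mathbb{Z}_\mathcal{G}$ with $(t,E)\le(s,E)$ we have $(t,E)\in\mathbb{Z}^\dagger_\mathcal{G}(r)$.
   Context: A cofinitary group is a subgroup $\mathcal{G}$ of the group $S_\infty$ of permutations of $\omega$ in which every non-identity element has only finitely many fixed points. Words: $W_\mathcal{G}$ is the set of words in the alphabet $\mathcal{G}\cup\{x,x^{ -1}\}$. For a (partial) injection $s$ and $w\in W_\mathcal{G}$, $w[s]$ is obtained by replacing $x,x^{ -1}$ by $s,s^{ -1}$ and composing (rightmost letter first); $\mathrm{fix}(w[s])=\{n: w[s](n)\text{ defined and }=n\}$. A word is nice if it is $x^k$ ($k>0$) or $g_lx^{k_l}\cdots g_1x^{k_1}g_0x^{k_0}$ with $k_0>0$, $k_i\in\mathbb{Z}\setminus\{0\}$, $g_i\in\mathcal{G}\setminus\{\mathrm{id}\}$; $W^*_\mathcal{G}$ is the set of nice words. A nice word $w$ is indecomposable if there are no $v\in W^*_\mathcal{G}$, $k>1$ with $v^k=w$; $W^\dagger_\mathcal{G}$ is the set of indecomposable nice words. $\mathbb{Z}_\mathcal{G}$ consists of pairs $(s,E)$, $s$ a finite partial injection $\omega\to\omega$, $E$ a finite subset of $W^*_\mathcal{G}$, with $(t,F)\le(s,E)$ iff $s\subseteq t$, $E\subseteq F$ and $\mathrm{fix}(w[t])=\mathrm{fix}(w[s])$ for all $w\in E$. For a finite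 partial injection $u$, $O_u(n)$ is the smallest set containing $n$ closed under $u,u^{ -1}$; an orbit $O$ is closed if $O\subseteq\mathrm{dom}(u)\cap\mathrm{ran}(u)$; $\mathcal{O}^c_u$ is the set of closed orbits. With $\langle p_n\rangle$ the increasing enumeration of the primes, $o^\dagger_u(n)=|\{O\in\mathcal{O}^c_u:|O|=p_n\}|\bmod2$, and $u$ codes $r$ up to $n$ if $r\restriction(n+1)=o^\dagger_u\restriction(n+1)$. $\mathbb{Z}^\dagger_\mathcal{G}(r)$ is the set of $(s,E)\in\mathbb{Z}_\mathcal{G}$ such that: $E$ is closed under cyclic permutations and inverses thereof (i.e. whenever such a word obtained from a member of $E$ is nice, it belongs to $E$), and for every $w\in E$, if $w=v^k$ with $v\in W^\dagger_\mathcal{G}$ and $k<\omega$, then $v^l\in E$ for all $0<l\le k$, and $v[s]$ codes $r$ up to $n$ for every $n$ with $p_n\le k$. It carries the order of $\mathbb{Z}_\mathcal{G}$. -}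

module Defs where

open import Data.Nat using (ℕ; zero; suc; _<_; _≤_; _%_)
open import Data.Nat.Primality using (Prime; prime?)
open import Data.Integer using (ℤ; +_; -[1+_])
open import Data.Bool using (Bool; if_then_else_)
open import Data.Product using (Σ; ∃; ∃-syntax; _×_; _,_)
open import Data.Sum using (_⊎_)
open import Data.List using (List; []; _∷_; _++_; length; filter; upTo; reverse; map; replicate)
open import Data.List.Membership.Propositional using (_∈_)
open import Data.List.Relation.Unary.All using (All)
open import Data.List.Relation.Unary.Unique.Propositional using (Unique)
open import Data.List.Relation.Unary.AllPairs using (AllPairs)
open import Relation.Nullary using (¬_)
open import Relation.Binary.PropositionalEquality using (_≡_; _≢_)
open import Function.Bundles using (_⇔_)

-- A cofinitary group is presented as a group (Carrier, e, _·_, inv) acting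
-- faithfully on ℕ by `act`; faithfulness makes the carrier isomorphic to the
-- image, a subgroup of S_∞ (each act g is a bijection with inverse act (inv g)),
-- and propositional equality on the carrier is equality of permutations.

record CofinitaryGroup : Set₁ where
  field
    Carrier  : Set
    e        : Carrier
    _·_      : Carrier → Carrier → Carrier
    inv      : Carrier → Carrier
    act      : Carrier → ℕ → ℕ
    act-e    : ∀ n → act e n ≡ n
    act-·    : ∀ g h n → act (g · h) n ≡ act g (act h n)
    act-invˡ : ∀ g n → act (inv g) (act g n) ≡ n
    act-invʳ : ∀ g n → act g (act (inv g) n) ≡ n
    faithful : ∀ g h → (∀ n → act g n ≡ act h n) → g ≡ h
    cofinitary : ∀ g → g ≢ e → ∃[ N ] (∀ n → act g n ≡ n → n < N)

module _ (G : CofinitaryGroup) where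
  open CofinitaryGroup G

  -- Words in the alphabet G ∪ {x, x⁻¹}; written left to right, applied
  -- rightmost letter first.

  data Letter : Set where
    gen  : Carrier → Letter
    x⁺   : Letter
    x⁻   : Letter

  Word : Set
  Word = List Letter

  xpow : ℤ → Word
  xpow (+ k)      = replicate k x⁺
  xpow (-[1+ k ]) = replicate (suc k) x⁻

  wpow : Word → ℕ → Word
  wpow v zero    = []
  wpow v (suc k) = v ++ wpow v k

  letterInv : Letter → Letter
  letterInv (gen g) = gen (inv g)
  letterInv x⁺      = x⁻
  letterInv x⁻      = x⁺

  winv : Word → Word
  winv w = reverse (map letterInv w)

  PInj : Set
  PInj = List (ℕ × ℕ)

  IsPInj : PInj → Set
  IsPInj s = ∀ a b c d → (a , b) ∈ s → (c , d) ∈ s → (a ≡ c → b ≡ d) × (b ≡ d → a ≡ c)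

  -- evaluation w[s] as a (partial functional) relation: Eval w s n m ⇔ w[s](n) = m
  LEval : Letter → PInj → ℕ → ℕ → Set
  LEval (gen g) s n m = act g n ≡ m
  LEval x⁺      s n m = (n , m) ∈ s
  LEval x⁻      s n m = (m , n) ∈ s

  data Eval : Word → PInj → ℕ → ℕ → Set where
    eval-[] : ∀ {s n} → Eval [] s n n
    eval-∷  : ∀ {l w s n k m} → Eval w s n k → LEval l s k m → Eval (l ∷ w) s n m

  Fix : Word → PInj → ℕ → Set
  Fix w s n = Eval w s n n

  -- blocks [(g₀,k₀), …, (g_l,k_l)] ↦ g_l x^{k_l} ⋯ g₀ x^{k₀}
  build : List (Carrier × ℤ) → Word
  build []             = []
  build ((g , k) ∷ bs) = build bs ++ (gen g ∷ xpow k)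

  NiceBlock : Carrier × ℤ → Set
  NiceBlock (g , k) = g ≢ e × k ≢ + 0

  Nice : Word → Set
  Nice w =
    (∃[ k ] (0 < k × w ≡ xpow (+ k)))
    ⊎ (∃[ g₀ ] ∃[ k₀ ] ∃[ bs ]
         (g₀ ≢ e × 0 < k₀ × All NiceBlock bs × w ≡ build ((g₀ , + k₀) ∷ bs)))

  Indecomposable : Word → Set
  Indecomposable w = Nice w × ¬ (∃[ v ] ∃[ k ] (Nice v × 1 < k × wpow v k ≡ w))

  data Conn (u : ℕ → ℕ → Set) : ℕ → ℕ → Set where
    conn-refl : ∀ {n} → Conn u n n
    conn-fwd  : ∀ {n k m} → u n k → Conn u k m → Conn u n m
    conn-bwd  : ∀ {n k m} → u k n → Conn u k m → Conn u n m

  ClosedOrbit : (ℕ → ℕ → Set) → ℕ → Set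
  ClosedOrbit u n = ∀ m → Conn u n m → (∃[ a ] u m a) × (∃[ b ] u b m)

  OrbitSize : (ℕ → ℕ → Set) → ℕ → ℕ → Set
  OrbitSize u n p = ∃[ L ] (Unique L × (∀ m → (m ∈ L ⇔ Conn u n m)) × length L ≡ p)

  GoodOrbit : (ℕ → ℕ → Set) → ℕ → ℕ → Set
  GoodOrbit u p n = ClosedOrbit u n × OrbitSize u n p

  -- |{O ∈ O^c_u : |O| = p}| = c, witnessed by a system of distinct
  -- representatives L (one element of each such orbit)
  OrbitCount : (ℕ → ℕ → Set) → ℕ → ℕ → Set
  OrbitCount u p c =
    ∃[ L ] ( length L ≡ c
           × All (GoodOrbit u p) L
           × AllPairs (λ a b → ¬ Conn u a b) L
           × (∀ n → GoodOrbit u p n → ∃[ a ] (a ∈ L × Conn u n a)))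

  -- p is the n-th prime p_n (p_0 = 2)
  NthPrime : ℕ → ℕ → Set
  NthPrime n p = Prime p × length (filter prime? (upTo p)) ≡ n

  bit : Bool → ℕ
  bit b = if b then 1 else 0

  -- o†_u(i) = r(i) for all i ≤ n
  Codes : (ℕ → ℕ → Set) → (ℕ → Bool) → ℕ → Set
  Codes u r n = ∀ i → i ≤ n → ∀ q → NthPrime i q →
                ∃[ c ] (OrbitCount u q c × c % 2 ≡ bit (r i))

  Cond : Set
  Cond = PInj × List Word

  InZ : Cond → Set
  InZ (s , E) = IsPInj s × All Nice E

  _≤Z_ : Cond → Cond → Set
  (t , F) ≤Z (s , E) =
    (∀ {p} → p ∈ s → p ∈ t)
    × (∀ {w} → w ∈ E → w ∈ F)
    × (∀ w → w ∈ E → ∀ n → (Fix w t n ⇔ Fix w s n))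

  CycClosed : List Word → Set
  CycClosed E = ∀ w → w ∈ E → ∀ a b → w ≡ a ++ b →
                  (Nice (b ++ a) → (b ++ a) ∈ E)
                × (Nice (winv (b ++ a)) → winv (b ++ a) ∈ E)

  InZdag : (ℕ → Bool) → Cond → Set
  InZdag r (s , E) =
    InZ (s , E) × CycClosed E
    × (∀ w → w ∈ E → ∀ v k → Indecomposable v → w ≡ wpow v k →
         (∀ l → 0 < l → l ≤ k → wpow v l ∈ E)
       × (∀ n p → NthPrime n p → p ≤ k → Codes (Eval v s) r n))

-- Since t ⊇ s is still a partial injection, a closed v[s]-orbit admits no new
-- v[t]-edges, so it remains a closed v[t]-orbit of the same size. Conversely, a
-- closed v[t]-orbit of size q ≤ k is a finite cycle, so each of its points is
-- fixed by v^d[t] for some 0 < d ≤ q. As v^d ∈ E, the condition (t,E) ≤ (s,E)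
-- makes the point fixed by v^d[s] as well; so v[s] is defined at it and at its
-- preimage, and the orbit was already closed for v[s]. Thus v[s] and v[t] have
-- the same closed orbits of each size p_n ≤ k and code r to the same extent.
module Submission where

open import Defs
open import Data.Nat using (ℕ; zero; suc; _+_; _∸_; _<_; _≤_; s≤s; _≤′_; ≤′-reflexive; ≤′-step)
open import Data.Nat.Properties
open import Data.Nat.Primality using (Prime; prime?)
open import Data.Bool using (Bool)
open import Data.List using (List; []; _∷_; _++_; length; filter; upTo; [_])
open import Data.List.Properties using (upTo-∷ʳ; filter-++; filter-accept; length-++; ++-assoc; ++-identityʳ)
open import Data.List.Membership.Propositional using (_∈_)
open import Data.List.Membership.Setoid.Properties using (index-injective)
open import Data.List.Relation.Unary.Any using (index)
open import Data.List.Relation.Unary.All as All using (All)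
open import Data.List.Relation.Unary.AllPairs using (AllPairs; []; _∷_)
open import Data.Fin using (Fin; toℕ)
open import Data.Fin.Properties using (pigeonhole; toℕ<n)
open import Data.Product using (∃₂; ∃-syntax; _×_; _,_; proj₁; proj₂)
open import Relation.Binary.PropositionalEquality using (_≡_; setoid; refl; sym; trans; cong; subst; subst₂; module ≡-Reasoning)
open import Function.Bundles using (mk⇔; Equivalence)

primeCount : ℕ → ℕ
primeCount m = length (filter prime? (upTo m))

primeCount-suc : ∀ m → primeCount (suc m) ≡ primeCount m + length (filter prime? [ m ])
primeCount-suc m = begin
    length (filter prime? (upTo (suc m)))
  ≡⟨ cong (λ ms → length (filter prime? ms)) (sym (upTo-∷ʳ m)) ⟩
    length (filter prime? (upTo m ++ [ m ]))
  ≡⟨ cong length (filter-++ prime? (upTo m) [ m ]) ⟩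
    length (filter prime? (upTo m) ++ filter prime? [ m ])
  ≡⟨ length-++ (filter prime? (upTo m)) ⟩
    primeCount m + length (filter prime? [ m ])
  ∎
  where open ≡-Reasoning

primeCount-mono-≤′ : ∀ {m n} → m ≤′ n → primeCount m ≤ primeCount n
primeCount-mono-≤′ (≤′-reflexive refl) = ≤-refl
primeCount-mono-≤′ (≤′-step {n} m≤′n) =
  ≤-trans (primeCount-mono-≤′ m≤′n)
          (subst (primeCount n ≤_) (sym (primeCount-suc n)) (m≤m+n _ _))

primeCount-prime : ∀ {p} → Prime p → primeCount (suc p) ≡ suc (primeCount p)
primeCount-prime {p} prime-p = begin
  primeCount (suc p)                              ≡⟨ primeCount-suc p ⟩
  primeCount p + length (filter prime? [ p ])     ≡⟨ cong (λ ps → primeCount p + length ps) (filter-accept prime? prime-p) ⟩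
  primeCount p + 1                                ≡⟨ +-comm (primeCount p) 1 ⟩
  suc (primeCount p)                              ∎
  where open ≡-Reasoning

NthPrime-mono : ∀ {G i n q p} → NthPrime G i q → NthPrime G n p → i ≤ n → q ≤ p
NthPrime-mono (_ , count-q) (prime-p , count-p) i≤n = ≮⇒≥ λ p<q →
  <⇒≱ (s≤s i≤n)
      (subst₂ _≤_ (trans (primeCount-prime prime-p) (cong suc count-p)) count-q
              (primeCount-mono-≤′ (≤⇒≤′ p<q)))

AllPairs-mapWithAll : ∀ {A : Set} {P : A → Set} {R S : A → A → Set} →
                      (∀ {a b} → P a → R a b → S a b) →
                      ∀ {L} → All P L → AllPairs R L → AllPairs S L
AllPairs-mapWithAll f All.[]          []            = []
AllPairs-mapWithAll f (pa All.∷ pas) (a-R-all ∷ R-pairs) = All.map (f pa) a-R-all ∷ AllPairs-mapWithAll f pas R-pairs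

module _ {G : CofinitaryGroup} where

  Conn-trans : ∀ {u a b c} → Conn G u a b → Conn G u b c → Conn G u a c
  Conn-trans conn-refl         b~c = b~c
  Conn-trans (conn-fwd uak a~b) b~c = conn-fwd uak (Conn-trans a~b b~c)
  Conn-trans (conn-bwd uka a~b) b~c = conn-bwd uka (Conn-trans a~b b~c)

  Conn-map : ∀ {u u′ : ℕ → ℕ → Set} → (∀ {a b} → u a b → u′ a b) →
             ∀ {a b} → Conn G u a b → Conn G u′ a b
  Conn-map f conn-refl         = conn-refl
  Conn-map f (conn-fwd uak a~b) = conn-fwd (f uak) (Conn-map f a~b)
  Conn-map f (conn-bwd uka a~b) = conn-bwd (f uka) (Conn-map f a~b)

  module _ {u u′ : ℕ → ℕ → Set}
           (u⊆u′       : ∀ {a b} → u a b → u′ a b)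
           (functional : ∀ {a b b′} → u′ a b → u′ a b′ → b ≡ b′)
           (injective  : ∀ {a a′ b} → u′ a b → u′ a′ b → a ≡ a′) where

    ClosedOrbit-Conn-reflect : ∀ {n} → ClosedOrbit G u n →
                               ∀ {a m} → Conn G u n a → Conn G u′ a m → Conn G u n m
    ClosedOrbit-Conn-reflect closed n~a conn-refl = n~a
    ClosedOrbit-Conn-reflect closed {a} n~a (conn-fwd u′ak k~m)
      with proj₁ (closed a n~a)
    ... | b , uab with functional (u⊆u′ uab) u′ak
    ... | refl = ClosedOrbit-Conn-reflect closed (Conn-trans n~a (conn-fwd uab conn-refl)) k~m
    ClosedOrbit-Conn-reflect closed {a} n~a (conn-bwd u′ka k~m)
      with proj₂ (closed a n~a)
    ... | b , uba with injective (u⊆u′ uba) u′ka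
    ... | refl = ClosedOrbit-Conn-reflect closed (Conn-trans n~a (conn-bwd uba conn-refl)) k~m

    ClosedOrbit-Conn-restrict : ∀ {n} → ClosedOrbit G u n → ∀ {m} → Conn G u′ n m → Conn G u n m
    ClosedOrbit-Conn-restrict closed = ClosedOrbit-Conn-reflect closed conn-refl

    ClosedOrbit-extend : ∀ {n} → ClosedOrbit G u n → ClosedOrbit G u′ n
    ClosedOrbit-extend closed m n~m with closed m (ClosedOrbit-Conn-restrict closed n~m)
    ... | (a , uma) , (b , ubm) = (a , u⊆u′ uma) , (b , u⊆u′ ubm)

    OrbitSize-extend : ∀ {n q} → ClosedOrbit G u n → OrbitSize G u n q → OrbitSize G u′ n q
    OrbitSize-extend closed (L , unique , L⇔orbit , length-L) = L , unique ,
      (λ m → mk⇔ (λ m∈L → Conn-map u⊆u′ (Equivalence.to (L⇔orbit m) m∈L))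
                 (λ n~m → Equivalence.from (L⇔orbit m) (ClosedOrbit-Conn-restrict closed n~m))) ,
      length-L

    OrbitSize-restrict : ∀ {n q} → ClosedOrbit G u n → OrbitSize G u′ n q → OrbitSize G u n q
    OrbitSize-restrict closed (L , unique , L⇔orbit , length-L) = L , unique ,
      (λ m → mk⇔ (λ m∈L → ClosedOrbit-Conn-restrict closed (Equivalence.to (L⇔orbit m) m∈L))
                 (λ n~m → Equivalence.from (L⇔orbit m) (Conn-map u⊆u′ n~m))) ,
      length-L

    OrbitCount-extend : ∀ {q c} → (∀ {n} → GoodOrbit G u′ q n → ClosedOrbit G u n) →
                        OrbitCount G u q c → OrbitCount G u′ q c
    OrbitCount-extend reflect (L , length-L , good , separated , covering) =
      L , length-L ,
      All.map (λ (closed , size) → ClosedOrbit-extend closed , OrbitSize-extend closed size) good ,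
      AllPairs-mapWithAll (λ (closed , _) a≁b a~b → a≁b (ClosedOrbit-Conn-restrict closed a~b)) good separated ,
      λ n good′ →
        let closed = reflect good′
            (a , a∈L , n~a) = covering n (closed , OrbitSize-restrict closed (proj₂ good′))
        in a , a∈L , Conn-map u⊆u′ n~a

module _ {G : CofinitaryGroup} where
  open CofinitaryGroup G

  Eval-++ : ∀ a {b s n k m} → Eval G b s n k → Eval G a s k m → Eval G (a ++ b) s n m
  Eval-++ []      eval-b eval-[]            = eval-b
  Eval-++ (l ∷ a) eval-b (eval-∷ eval-a el) = eval-∷ (Eval-++ a eval-b eval-a) el

  Eval-++⁻ : ∀ a {b s n m} → Eval G (a ++ b) s n m → ∃[ k ] (Eval G b s n k × Eval G a s k m)
  Eval-++⁻ []      eval-b = _ , eval-b , eval-[]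
  Eval-++⁻ (l ∷ a) (eval-∷ eval-ab el) with Eval-++⁻ a eval-ab
  ... | k , eval-b , eval-a = k , eval-b , eval-∷ eval-a el

  wpow-+ : ∀ v i j → wpow G v (i + j) ≡ wpow G v i ++ wpow G v j
  wpow-+ v zero    j = refl
  wpow-+ v (suc i) j = trans (cong (v ++_) (wpow-+ v i j)) (sym (++-assoc v _ _))

  wpow-sucʳ : ∀ v d → wpow G v (suc d) ≡ wpow G v d ++ v
  wpow-sucʳ v d = begin
    wpow G v (suc d)          ≡⟨ cong (wpow G v) (+-comm 1 d) ⟩
    wpow G v (d + 1)          ≡⟨ wpow-+ v d 1 ⟩
    wpow G v d ++ (v ++ [])   ≡⟨ cong (wpow G v d ++_) (++-identityʳ v) ⟩
    wpow G v d ++ v           ∎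
    where open ≡-Reasoning

  wpow-split : ∀ v {i j} → i ≤ j → wpow G v j ≡ wpow G v i ++ wpow G v (j ∸ i)
  wpow-split v {i} {j} i≤j = trans (cong (wpow G v) (sym (m+[n∸m]≡n i≤j))) (wpow-+ v i (j ∸ i))

  Eval-mono : ∀ {s t} → (∀ {p} → p ∈ s → p ∈ t) → ∀ {w n m} → Eval G w s n m → Eval G w t n m
  Eval-mono s⊆t eval-[] = eval-[]
  Eval-mono s⊆t (eval-∷ {l = gen g} eval-w el) = eval-∷ (Eval-mono s⊆t eval-w) el
  Eval-mono s⊆t (eval-∷ {l = x⁺}    eval-w el) = eval-∷ (Eval-mono s⊆t eval-w) (s⊆t el)
  Eval-mono s⊆t (eval-∷ {l = x⁻}    eval-w el) = eval-∷ (Eval-mono s⊆t eval-w) (s⊆t el)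

  module _ {t} (injective-t : IsPInj G t) where

    LEval-functional : ∀ l {k m m′} → LEval G l t k m → LEval G l t k m′ → m ≡ m′
    LEval-functional (gen g) gk≡m gk≡m′ = trans (sym gk≡m) gk≡m′
    LEval-functional x⁺ km km′ = proj₁ (injective-t _ _ _ _ km km′) refl
    LEval-functional x⁻ mk m′k = proj₂ (injective-t _ _ _ _ mk m′k) refl

    LEval-injective : ∀ l {k k′ m} → LEval G l t k m → LEval G l t k′ m → k ≡ k′
    LEval-injective (gen g) {k} {k′} gk≡m gk′≡m = begin
      k                       ≡⟨ sym (act-invˡ g k) ⟩
      act (inv g) (act g k)   ≡⟨ cong (act (inv g)) (trans gk≡m (sym gk′≡m)) ⟩
      act (inv g) (act g k′)  ≡⟨ act-invˡ g k′ ⟩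
      k′                      ∎
      where open ≡-Reasoning
    LEval-injective x⁺ km k′m = proj₂ (injective-t _ _ _ _ km k′m) refl
    LEval-injective x⁻ mk mk′ = proj₁ (injective-t _ _ _ _ mk mk′) refl

    Eval-functional : ∀ {w n m m′} → Eval G w t n m → Eval G w t n m′ → m ≡ m′
    Eval-functional eval-[] eval-[] = refl
    Eval-functional (eval-∷ {l = l} eval-w el) (eval-∷ eval-w′ el′)
      with Eval-functional eval-w eval-w′
    ... | refl = LEval-functional l el el′

    Eval-injective : ∀ {w n n′ m} → Eval G w t n m → Eval G w t n′ m → n ≡ n′
    Eval-injective eval-[] eval-[] = refl
    Eval-injective (eval-∷ {l = l} eval-w el) (eval-∷ eval-w′ el′)
      with LEval-injective l el el′
    ... | refl = Eval-injective eval-w eval-w′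

    Fix-wpow-∸ : ∀ {v i j m y} → i ≤ j → Eval G (wpow G v i) t m y → Eval G (wpow G v j) t m y →
                 Fix G (wpow G v (j ∸ i)) t m
    Fix-wpow-∸ {v} {i} {j} {m} {y} i≤j eval-i eval-j
      with Eval-++⁻ (wpow G v i) (subst (λ w → Eval G w t m y) (wpow-split v i≤j) eval-j)
    ... | z , eval-j∸i , eval-i′ with Eval-injective eval-i′ eval-i
    ... | refl = eval-j∸i

    -- Iterating v[t] from m stays in the orbit; by pigeonhole two of the first
    -- q + 1 iterates coincide, and injectivity cancels the common prefix.
    ClosedOrbit-periodic : ∀ {v n q} → ClosedOrbit G (Eval G v t) n → OrbitSize G (Eval G v t) n q →
                           ∀ {m} → Conn G (Eval G v t) n m →
                           ∃[ d ] (0 < d × d ≤ q × Fix G (wpow G v d) t m)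
    ClosedOrbit-periodic {v} {n} closed (L , _ , L⇔orbit , refl) {m} n~m = period (pigeonhole ≤-refl position)
      where
      iterate : ∀ i → ∃[ y ] (Eval G (wpow G v i) t m y × Conn G (Eval G v t) n y)
      iterate zero = m , eval-[] , n~m
      iterate (suc i) with iterate i
      ... | y , eval-y , n~y with proj₁ (closed y n~y)
      ... | z , vyz = z , Eval-++ v eval-y vyz , Conn-trans n~y (conn-fwd vyz conn-refl)

      iterate-∈L : ∀ i → proj₁ (iterate i) ∈ L
      iterate-∈L i = Equivalence.from (L⇔orbit _) (proj₂ (proj₂ (iterate i)))

      position : Fin (suc (length L)) → Fin (length L)
      position i = index (iterate-∈L (toℕ i))

      period : ∃₂ (λ i j → toℕ i < toℕ j × position i ≡ position j) →
               ∃[ d ] (0 < d × d ≤ length L × Fix G (wpow G v d) t m)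
      period (i , j , i<j , same-position) =
        toℕ j ∸ toℕ i , m<n⇒0<n∸m i<j , ≤-trans (m∸n≤m (toℕ j) (toℕ i)) (≤-pred (toℕ<n j)) ,
        Fix-wpow-∸ (<⇒≤ i<j) (proj₁ (proj₂ (iterate (toℕ i)))) (subst (Eval G (wpow G v (toℕ j)) t m) same-iterate (proj₁ (proj₂ (iterate (toℕ j)))))
        where
        same-iterate : proj₁ (iterate (toℕ j)) ≡ proj₁ (iterate (toℕ i))
        same-iterate = index-injective (setoid ℕ) (iterate-∈L (toℕ j)) (iterate-∈L (toℕ i)) (sym same-position)

  module _ {s t} (s⊆t : ∀ {p} → p ∈ s → p ∈ t) (injective-t : IsPInj G t) where

    GoodOrbit-restrict : ∀ {v q n} →
                         (∀ d → 0 < d → d ≤ q → ∀ m → Fix G (wpow G v d) t m → Fix G (wpow G v d) s m) →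
                         GoodOrbit G (Eval G v t) q n → ClosedOrbit G (Eval G v s) n
    GoodOrbit-restrict {v} fix-reflect (closed , size) m n~m
      with ClosedOrbit-periodic injective-t closed size (Conn-map (Eval-mono s⊆t) n~m)
    ... | suc d , 0<d , d<q , fix-t = successor , predecessor
      where
      fix-s : Fix G (wpow G v (suc d)) s m
      fix-s = fix-reflect (suc d) 0<d d<q m fix-t

      successor : ∃[ a ] Eval G v s m a
      successor with Eval-++⁻ (wpow G v d) (subst (λ w → Fix G w s m) (wpow-sucʳ v d) fix-s)
      ... | a , vma , _ = a , vma

      predecessor : ∃[ b ] Eval G v s b m
      predecessor with Eval-++⁻ v fix-s
      ... | b , _ , vbm = b , vbm

    Codes-extend : ∀ {v r n p} → NthPrime G n p →
                   (∀ d → 0 < d → d ≤ p → ∀ m → Fix G (wpow G v d) t m → Fix G (wpow G v d) s m) →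
                   Codes G (Eval G v s) r n → Codes G (Eval G v t) r n
    Codes-extend {v} nth-p fix-reflect codes i i≤n q nth-q with codes i i≤n q nth-q
    ... | c , count , parity =
      c , OrbitCount-extend (Eval-mono s⊆t) (Eval-functional injective-t) (Eval-injective injective-t)
                            (GoodOrbit-restrict fix-reflect-q) count , parity
      where
      fix-reflect-q : ∀ d → 0 < d → d ≤ q → ∀ m → Fix G (wpow G v d) t m → Fix G (wpow G v d) s m
      fix-reflect-q = λ d 0<d d≤q → fix-reflect d 0<d (≤-trans d≤q (NthPrime-mono {G = G} nth-q nth-p i≤n))

proposition4p19 : (G : CofinitaryGroup) (r : ℕ → Bool) (s t : PInj G) (E : List (Word G)) →
    InZdag G r (s , E) → InZ G (t , E) → _≤Z_ G (t , E) (s , E) → InZdag G r (t , E)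
proposition4p19 G r s t E (_ , cyclic , powers) inZ-t@(injective-t , _) (s⊆t , _ , fix-t⇔s) =
  inZ-t , cyclic , λ w w∈E v k indecomposable w≡vᵏ →
    let (powers∈E , codes) = powers w w∈E v k indecomposable w≡vᵏ
        fix-reflect : ∀ {p} → p ≤ k → ∀ d → 0 < d → d ≤ p → ∀ m →
                      Fix G (wpow G v d) t m → Fix G (wpow G v d) s m
        fix-reflect p≤k d 0<d d≤p m =
          Equivalence.to (fix-t⇔s (wpow G v d) (powers∈E d 0<d (≤-trans d≤p p≤k)) m)
    in powers∈E , λ n p nth-p p≤k →
         Codes-extend s⊆t injective-t nth-p (fix-reflect p≤k) (codes n p nth-p p≤k)
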